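{- Let $\phi$ be a numbering and $p$ a positive integer such that for every numbering $\psi$ there is a positive integer $c$ such that for every $e$ there is $j\le ce^p+c$ with $\phi_j=\psi_e$ (i.e., $\phi$ is polynomially bounded with degree $p$). Let $d(k)=p^{k-1}+p^{k-2}+\dots+1$. Then there exists a positive integer $a$ such that for every sufficiently large $n$ the interval $I_n=\{2^{a d(n)}+1,\dots,2^{a d(n+1)}\}$ satisfies \[|M_\phi\cap I_n|>2^{ -ap^n}\cdot |I_n|.\] In particular, when $p=1$ (the Kolmogorov property), $M_\phi\cap I_n$ contains at least a constant fraction of the elements of $I_n$.
   Context: A numbering $\phi$ is given by a partial-recursive function $U:\mathbb{N}^2\to\mathbb{N}$ via $\phi_e(x)=U(e,x)$. $\mathrm{MIN}_\phi=\{e:(\forall j<e)\,[\phi_j\ne\phi_e]\}$, and $M_\phi=\{e: e\in\mathrm{MIN}_\phi \text{ and } \phi_e \text{ converges only on input } 0\}$. -}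

module Defs where

open import Data.Nat using (ℕ; zero; suc; _+_; _*_; _∸_; _^_; _≤_; _<_)
open import Data.Fin using (Fin)
open import Data.Vec using (Vec; []; _∷_; lookup)
open import Data.List using (List; length)
open import Data.List.Relation.Unary.All using (All)
open import Data.List.Relation.Unary.Unique.Propositional using (Unique)
open import Data.Product using (Σ; ∃; _×_)
open import Relation.Binary.PropositionalEquality using (_≡_)
open import Relation.Nullary using (¬_)
open import Function.Bundles using (_⇔_)

data PR : ℕ → Set where
  zeroF : ∀ {n} → PR n
  succF : PR 1
  projF : ∀ {n} → Fin n → PR n
  compF : ∀ {m n} → PR m → Vec (PR n) m → PR n
  recF  : ∀ {n} → PR n → PR (suc (suc n)) → PR (suc n)
  muF   : ∀ {n} → PR (suc n) → PR n

mutual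
  data _[_]⇓_ : ∀ {n} → PR n → Vec ℕ n → ℕ → Set where
    ev-zero : ∀ {n} {xs : Vec ℕ n} → zeroF [ xs ]⇓ 0
    ev-succ : ∀ {x} → succF [ x ∷ [] ]⇓ suc x
    ev-proj : ∀ {n} {i : Fin n} {xs} → projF i [ xs ]⇓ lookup xs i
    ev-comp : ∀ {m n} {f : PR m} {gs : Vec (PR n) m} {xs ys y} →
              gs [ xs ]⇓* ys → f [ ys ]⇓ y → compF f gs [ xs ]⇓ y
    ev-rec0 : ∀ {n} {f : PR n} {g} {xs y} →
              f [ xs ]⇓ y → recF f g [ 0 ∷ xs ]⇓ y
    ev-recS : ∀ {n} {f : PR n} {g} {k xs r y} →
              recF f g [ k ∷ xs ]⇓ r → g [ k ∷ r ∷ xs ]⇓ y →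
              recF f g [ suc k ∷ xs ]⇓ y
    ev-mu   : ∀ {n} {f : PR (suc n)} {xs k} →
              f [ k ∷ xs ]⇓ 0 →
              (∀ i → i < k → ∃ λ v → f [ i ∷ xs ]⇓ suc v) →
              muF f [ xs ]⇓ k

  data _[_]⇓*_ : ∀ {m n} → Vec (PR n) m → Vec ℕ n → Vec ℕ m → Set where
    ev-[] : ∀ {n} {xs : Vec ℕ n} → [] [ xs ]⇓* []
    ev-∷  : ∀ {m n} {g : PR n} {gs : Vec (PR n) m} {xs y ys} →
            g [ xs ]⇓ y → gs [ xs ]⇓* ys → (g ∷ gs) [ xs ]⇓* (y ∷ ys)

-- A numbering is given by a partial recursive U : ℕ² → ℕ, φ_e(x) = U(e,x).
Numbering : Set
Numbering = PR 2

_⟨_⟩_⇓_ : Numbering → ℕ → ℕ → ℕ → Set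
φ ⟨ e ⟩ x ⇓ y = φ [ e ∷ x ∷ [] ]⇓ y

SameFn : Numbering → ℕ → Numbering → ℕ → Set
SameFn φ j ψ e = ∀ x y → (φ ⟨ j ⟩ x ⇓ y) ⇔ (ψ ⟨ e ⟩ x ⇓ y)

MIN : Numbering → ℕ → Set
MIN φ e = ∀ j → j < e → ¬ SameFn φ j φ e

ConvOnlyOn0 : Numbering → ℕ → Set
ConvOnlyOn0 φ e = (∃ λ y → φ ⟨ e ⟩ 0 ⇓ y) × (∀ x y → φ ⟨ e ⟩ x ⇓ y → x ≡ 0)

M : Numbering → ℕ → Set
M φ e = MIN φ e × ConvOnlyOn0 φ e

PolyBounded : Numbering → ℕ → Set
PolyBounded φ p = ∀ (ψ : Numbering) → Σ ℕ λ c → 1 ≤ c ×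
  (∀ e → Σ ℕ λ j → j ≤ c * e ^ p + c × SameFn φ j ψ e)

d : ℕ → ℕ → ℕ
d p zero    = 0
d p (suc k) = p ^ k + d p k

-- |P ∩ {lo+1,…,hi}| · 2^s > hi - lo, i.e. |P ∩ I| > 2^(-s) · |I|
ScaledMoreThan : ℕ → (ℕ → Set) → ℕ → ℕ → Set
ScaledMoreThan s P lo hi = Σ (List ℕ) λ es →
  Unique es × All (λ e → lo < e × e ≤ hi × P e) es × hi ∸ lo < length es * 2 ^ s

module Submission where

-- Let χ be the numbering with χ_e(0) = e and χ_e(x) undefined
-- for x > 0.  Because φ is polynomially bounded there is c such that χ_e has
-- a φ-index ≤ c·e^p + c; the least such index m(e) lies in MIN_φ, and φ_{m(e)}
-- converges exactly on 0, so m(e) ∈ M_φ.  Since φ_{m(e)}(0) = e, the map m is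
-- injective.  Put a = 2c·4^p, lo = 2^(a·d(n)), hi = 2^(a·d(n+1)).  The 2(lo+1)
-- numbers m(0), …, m(2lo+1) are distinct and ≤ c·(4lo)^p + c ≤ 2^a·lo^p = hi;
-- at most lo+1 of them are ≤ lo, so at least lo+1 lie in I_n, and
-- |I_n| < hi = 2^(a·p^n)·lo < 2^(a·p^n)·(lo+1).

open import Defs
open import Data.Nat using (ℕ; zero; suc; _+_; _*_; _∸_; _^_; _≤_; _<_; z≤n; s≤s; _<?_)
open import Data.Nat.Properties
open import Data.Nat.Induction using (<-wellFounded)
open import Data.Nat.Tactic.RingSolver using (solve-∀)
open import Data.Fin using (Fin)
import Data.Fin as Fin
open import Data.Vec using ([]; _∷_; lookup)
open import Data.List using (List; []; _∷_; length; map; filter; upTo)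
open import Data.List.Properties using (length-map; length-upTo)
open import Data.List.Relation.Unary.All as All using (All; []; _∷_)
import Data.List.Relation.Unary.All.Properties as AllP
open import Data.List.Relation.Unary.AllPairs using (_∷_)
open import Data.List.Relation.Unary.Unique.Propositional using (Unique)
import Data.List.Relation.Unary.Unique.Propositional.Properties as UniqueP
open import Data.Product using (Σ; _×_; _,_; proj₁; proj₂)
open import Data.Empty using (⊥-elim)
open import Function.Base using (_∘_)
open import Function.Bundles using (Equivalence)
open import Function.Construct.Composition using (_⇔-∘_)
open import Induction.WellFounded using (Acc; acc)
open import Relation.Nullary using (¬_; yes; no)
open import Relation.Unary using (Pred; Decidable)
open import Relation.Unary.Properties using (∁?)
open import Relation.Binary.PropositionalEquality using (_≡_; refl; sym; trans; cong; subst)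
open import Axiom.ExcludedMiddle using (ExcludedMiddle)
open import Level using (0ℓ)

open Equivalence using (to; from)

module _ {P : Pred ℕ 0ℓ} (P? : Decidable P) where

  least-witness : ∀ {j} → P j →
    Σ ℕ λ m → m ≤ j × P m × (∀ k → k < m → ¬ P k)
  least-witness {j} = go j (<-wellFounded j)
    where
    go : ∀ j → Acc _<_ j → P j → Σ ℕ λ m → m ≤ j × P m × (∀ k → k < m → ¬ P k)
    go j (acc below) Pj with anyUpTo? P? j
    ... | no none = j , ≤-refl , Pj , λ k k<j Pk → none (k , k<j , Pk)
    ... | yes (k , k<j , Pk) with go k (below k<j) Pk
    ...   | m , m≤k , Pm , minimal = m , ≤-trans m≤k (<⇒≤ k<j) , Pm , minimal

  length-filter-split : ∀ xs →
    length xs ≡ length (filter P? xs) + length (filter (∁? P?) xs)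
  length-filter-split [] = refl
  length-filter-split (x ∷ xs) with P? x
  ... | yes _ = cong suc (length-filter-split xs)
  ... | no _  = trans (cong suc (length-filter-split xs)) (sym (+-suc _ _))

distinct-constant : ∀ {k : ℕ} xs → Unique xs → All (_≡ k) xs → length xs ≤ 1
distinct-constant []                _                   _                  = z≤n
distinct-constant (_ ∷ [])          _                   _                  = ≤-refl
distinct-constant (_ ∷ _ ∷ _) ((x≢y ∷ _) ∷ _) (refl ∷ refl ∷ _) = ⊥-elim (x≢y refl)

-- Pigeonhole: a duplicate-free list of numbers below k has at most k entries.
-- The entries below k-1 are counted inductively, the others all equal k-1.
distinct-below : ∀ k xs → Unique xs → All (_< k) xs → length xs ≤ k
distinct-below zero    []       _ _        = z≤n
distinct-below zero    (_ ∷ _)  _ (() ∷ _)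
distinct-below (suc k) xs distinct bounded = begin
  length xs                      ≡⟨ length-filter-split (_<? k) xs ⟩
  length lower + length top      ≤⟨ +-mono-≤ lower-count top-count ⟩
  k + 1                          ≡⟨ +-comm k 1 ⟩
  suc k                          ∎
  where
  open ≤-Reasoning
  lower top : List ℕ
  lower = filter (_<? k) xs
  top   = filter (∁? (_<? k)) xs
  lower-count : length lower ≤ k
  lower-count = distinct-below k lower (UniqueP.filter⁺ (_<? k) distinct)
                  (AllP.all-filter (_<? k) xs)
  top-is-k : All (_≡ k) top
  top-is-k = All.zipWith (λ (x<1+k , x≮k) → ≤-antisym (≤-pred x<1+k) (≮⇒≥ x≮k))
               (AllP.filter⁺ (∁? (_<? k)) bounded , AllP.all-filter (∁? (_<? k)) xs)
  top-count : length top ≤ 1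
  top-count = distinct-constant top (UniqueP.filter⁺ (∁? (_<? k)) distinct) top-is-k

distinct-above : ∀ lo xs → Unique xs → length xs ≤ suc lo + length (filter (lo <?_) xs)
distinct-above lo xs distinct = begin
  length xs                        ≡⟨ length-filter-split (lo <?_) xs ⟩
  length above + length rest       ≤⟨ +-monoʳ-≤ (length above) rest-count ⟩
  length above + suc lo            ≡⟨ +-comm (length above) (suc lo) ⟩
  suc lo + length above            ∎
  where
  open ≤-Reasoning
  above rest : List ℕ
  above = filter (lo <?_) xs
  rest  = filter (∁? (lo <?_)) xs
  rest-count : length rest ≤ suc lo
  rest-count = distinct-below (suc lo) rest (UniqueP.filter⁺ (∁? (lo <?_)) distinct)
                 (All.map (s≤s ∘ ≮⇒≥) (AllP.all-filter (∁? (lo <?_)) xs))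

interval-count : ∀ {P : ℕ → Set} s lo hi (f : ℕ → ℕ) → hi ≤ lo * 2 ^ s →
  (∀ {e e'} → f e ≡ f e' → e ≡ e') →
  (∀ e → e < 2 * suc lo → f e ≤ hi × P (f e)) →
  ScaledMoreThan s P lo hi
interval-count {P} s lo hi f hi≤ f-injective f-range =
  filter (lo <?_) values , UniqueP.filter⁺ (lo <?_) distinct , in-interval , count
  where
  values : List ℕ
  values = map f (upTo (2 * suc lo))
  distinct : Unique values
  distinct = UniqueP.map⁺ f-injective (UniqueP.upTo⁺ (2 * suc lo))
  in-range : All (λ x → x ≤ hi × P x) values
  in-range = AllP.map⁺ (AllP.applyUpTo⁺₁ (λ e → e) (2 * suc lo) (f-range _))
  in-interval : All (λ x → lo < x × x ≤ hi × P x) (filter (lo <?_) values)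
  in-interval = All.zip (AllP.all-filter (lo <?_) values , AllP.filter⁺ (lo <?_) in-range)
  enough : suc lo ≤ length (filter (lo <?_) values)
  enough = +-cancelˡ-≤ (suc lo) (suc lo) _ (begin
    suc lo + suc lo          ≡⟨ cong (suc lo +_) (sym (+-identityʳ (suc lo))) ⟩
    2 * suc lo               ≡⟨ sym (trans (length-map f (upTo (2 * suc lo))) (length-upTo (2 * suc lo))) ⟩
    length values            ≤⟨ distinct-above lo values distinct ⟩
    suc lo + length (filter (lo <?_) values) ∎)
    where open ≤-Reasoning
  count : hi ∸ lo < length (filter (lo <?_) values) * 2 ^ s
  count = begin-strict
    hi ∸ lo                  ≤⟨ m∸n≤m hi lo ⟩
    hi                       ≤⟨ hi≤ ⟩
    lo * 2 ^ s               <⟨ +-monoˡ-≤ (lo * 2 ^ s) (m^n>0 2 s) ⟩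
    suc lo * 2 ^ s           ≤⟨ *-monoˡ-≤ (2 ^ s) enough ⟩
    length (filter (lo <?_) values) * 2 ^ s ∎
    where open ≤-Reasoning

SameFn-trans : ∀ {φ ξ ψ i j k} → SameFn φ i ξ j → SameFn ξ j ψ k → SameFn φ i ψ k
SameFn-trans same₁ same₂ x y = same₂ x y ⇔-∘ same₁ x y

minimal-index : ExcludedMiddle 0ℓ → ∀ φ ψ e j → SameFn φ j ψ e →
  Σ ℕ λ m → m ≤ j × SameFn φ m ψ e × MIN φ m
minimal-index lem φ ψ e j same with least-witness (λ i → lem {SameFn φ i ψ e}) same
... | m , m≤j , same-m , below = m , m≤j , same-m ,
      λ k k<m same-k → below k k<m (SameFn-trans same-k same-m)

-- The partial function x ↦ 0 if x = 0, undefined otherwise.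
zero-only : PR 1
zero-only = muF (projF (Fin.suc Fin.zero))

-- The numbering χ with χ_e(0) = e and χ_e(x) undefined for x > 0.
χ : Numbering
χ = compF (projF Fin.zero)
      (projF Fin.zero ∷ compF zero-only (projF (Fin.suc Fin.zero) ∷ []) ∷ [])

χ-at-zero : ∀ e → χ ⟨ e ⟩ 0 ⇓ e
χ-at-zero e = ev-comp
  (ev-∷ ev-proj (ev-∷ (ev-comp (ev-∷ ev-proj ev-[]) (ev-mu {k = 0} ev-proj λ _ ())) ev-[]))
  ev-proj

projF-value : ∀ {n} {i : Fin n} {xs y} → projF i [ xs ]⇓ y → y ≡ lookup xs i
projF-value ev-proj = refl

zero-only-domain : ∀ {x y} → zero-only [ x ∷ [] ]⇓ y → x ≡ 0
zero-only-domain (ev-mu x≡0 _) = sym (projF-value x≡0)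

χ-converges : ∀ {e x y} → χ ⟨ e ⟩ x ⇓ y → x ≡ 0 × y ≡ e
χ-converges (ev-comp (ev-∷ first (ev-∷ (ev-comp (ev-∷ arg ev-[]) test) ev-[])) outer)
  rewrite projF-value first | projF-value arg | projF-value outer = zero-only-domain test , refl

χ-index-in-M : ∀ {φ e m} → SameFn φ m χ e → MIN φ m → M φ m
χ-index-in-M {e = e} same minimal =
  minimal , (e , from (same 0 e) (χ-at-zero e)) , λ x y conv → proj₁ (χ-converges (to (same x y) conv))

χ-index-determines : ∀ {φ e e' m} → SameFn φ m χ e → SameFn φ m χ e' → e ≡ e'
χ-index-determines {e = e} same same' = proj₂ (χ-converges (to (same' 0 e) (from (same 0 e) (χ-at-zero e))))

χ-indices : ExcludedMiddle 0ℓ → ∀ φ p → PolyBounded φ p →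
  Σ ℕ λ c → 1 ≤ c × Σ (ℕ → ℕ) λ m → (∀ {e e'} → m e ≡ m e' → e ≡ e') ×
    (∀ e → m e ≤ c * e ^ p + c × M φ (m e))
χ-indices lem φ p bounded = c , 1≤c , index , injective , good
  where
  c : ℕ
  c = proj₁ (bounded χ)
  1≤c : 1 ≤ c
  1≤c = proj₁ (proj₂ (bounded χ))
  least : ∀ e → Σ ℕ λ m → m ≤ c * e ^ p + c × SameFn φ m χ e × MIN φ m
  least e with proj₂ (proj₂ (bounded χ)) e
  ... | j , j≤ , same with minimal-index lem φ χ e j same
  ...   | m , m≤j , same-m , minimal = m , ≤-trans m≤j j≤ , same-m , minimal
  index : ℕ → ℕ
  index e = proj₁ (least e)
  represents : ∀ e → SameFn φ (index e) χ e
  represents e = proj₁ (proj₂ (proj₂ (least e)))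
  injective : ∀ {e e'} → index e ≡ index e' → e ≡ e'
  injective {e} {e'} eq =
    χ-index-determines (represents e) (subst (λ m → SameFn φ m χ e') (sym eq) (represents e'))
  good : ∀ e → index e ≤ c * e ^ p + c × M φ (index e)
  good e = proj₁ (proj₂ (least e)) , χ-index-in-M (represents e) (proj₂ (proj₂ (proj₂ (least e))))

horner-step : ∀ p u v → p * u + (v * p + 1) ≡ (u + v) * p + 1
horner-step = solve-∀

scale-out : ∀ a v p → a * (v * p + 1) ≡ a * v * p + a
scale-out = solve-∀

double-product : ∀ c x y → c * (x * y) + c * (x * y) ≡ y * (2 * (c * x))
double-product = solve-∀

d-horner : ∀ p n → d p (suc n) ≡ d p n * p + 1
d-horner p zero    = refl
d-horner p (suc n) = trans (cong (p ^ suc n +_) (d-horner p n)) (horner-step p (p ^ n) (d p n))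

exponent-step : ∀ a p n → a * d p (n + 1) ≡ a * p ^ n + a * d p n
exponent-step a p n = trans (cong (λ k → a * d p k) (+-comm n 1)) (*-distribˡ-+ a (p ^ n) (d p n))

exponent-horner : ∀ a p n → a * d p (n + 1) ≡ a * d p n * p + a
exponent-horner a p n =
  trans (cong (λ k → a * d p k) (+-comm n 1)) (trans (cong (a *_) (d-horner p n)) (scale-out a (d p n) p))

-- Exponential growth dominates: used to absorb the factor a into 2^a.
n<2^n : ∀ n → n < 2 ^ n
n<2^n zero    = s≤s z≤n
n<2^n (suc n) = begin-strict
  suc n              ≡⟨ +-comm 1 n ⟩
  n + 1              <⟨ +-mono-≤ (n<2^n n) (m^n>0 2 n) ⟩
  2 ^ n + 2 ^ n      ≡⟨ cong (2 ^ n +_) (sym (+-identityʳ (2 ^ n))) ⟩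
  2 ^ suc n          ∎
  where open ≤-Reasoning

below-double-succ : ∀ {x e} → 1 ≤ x → e < 2 * suc x → e ≤ 2 * (2 * x)
below-double-succ {x} {e} 1≤x e<2x+2 = begin
  e                  ≤⟨ ≤-pred (≤-trans e<2x+2 (≤-reflexive (*-suc 2 x))) ⟩
  1 + 2 * x          ≤⟨ +-monoˡ-≤ (2 * x) (≤-trans 1≤x (m≤m+n x (x + 0))) ⟩
  2 * x + 2 * x      ≡⟨ cong (2 * x +_) (sym (+-identityʳ (2 * x))) ⟩
  2 * (2 * x)        ∎
  where open ≤-Reasoning

power-bound : ∀ c p k L e → e ≤ 2 ^ (k + L) → c * e ^ p + c ≤ 2 ^ (L * p) * (2 * (c * 2 ^ (k * p)))
power-bound c p k L e e≤ = begin
  c * e ^ p + c              ≤⟨ +-mono-≤ (*-monoʳ-≤ c e^p≤) c≤ ⟩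
  c * power + c * power      ≡⟨ cong (λ q → c * q + c * q) (^-distribˡ-+-* 2 (k * p) (L * p)) ⟩
  c * (2 ^ (k * p) * 2 ^ (L * p)) + c * (2 ^ (k * p) * 2 ^ (L * p))
                             ≡⟨ double-product c (2 ^ (k * p)) (2 ^ (L * p)) ⟩
  2 ^ (L * p) * (2 * (c * 2 ^ (k * p))) ∎
  where
  open ≤-Reasoning
  power : ℕ
  power = 2 ^ (k * p + L * p)
  e^p≤ : e ^ p ≤ power
  e^p≤ = ≤-trans (^-monoˡ-≤ p e≤)
           (≤-reflexive (trans (^-*-assoc 2 (k + L) p) (cong (2 ^_) (*-distribʳ-+ p k L))))
  c≤ : c ≤ c * power
  c≤ = ≤-trans (≤-reflexive (sym (*-identityʳ c))) (*-monoʳ-≤ c (m^n>0 2 (k * p + L * p)))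

scale : ℕ → ℕ → ℕ
scale c p = 2 * (c * 2 ^ (2 * p))

scale-positive : ∀ {c} p → 1 ≤ c → 1 ≤ scale c p
scale-positive {c} p 1≤c =
  ≤-trans (*-mono-≤ 1≤c (m^n>0 2 (2 * p))) (m≤m+n (c * 2 ^ (2 * p)) (c * 2 ^ (2 * p) + 0))

dense-intervals : ∀ {P : ℕ → Set} c p (m : ℕ → ℕ) →
  (∀ {e e'} → m e ≡ m e' → e ≡ e') → (∀ e → m e ≤ c * e ^ p + c × P (m e)) →
  let a = scale c p in
  ∀ n → ScaledMoreThan (a * p ^ n) P (2 ^ (a * d p n)) (2 ^ (a * d p (n + 1)))
dense-intervals c p m m-injective m-good n =
  interval-count s lo hi m hi≤lo·2^s m-injective (λ e e< → ≤-trans (proj₁ (m-good e)) (growth e e<) , proj₂ (m-good e))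
  where
  a L s lo hi : ℕ
  a = scale c p
  L = a * d p n
  s = a * p ^ n
  lo = 2 ^ L
  hi = 2 ^ (a * d p (n + 1))
  hi≤lo·2^s : hi ≤ lo * 2 ^ s
  hi≤lo·2^s = ≤-reflexive (trans (cong (2 ^_) (exponent-step a p n))
                (trans (^-distribˡ-+-* 2 s L) (*-comm (2 ^ s) lo)))
  growth : ∀ e → e < 2 * suc lo → c * e ^ p + c ≤ hi
  growth e e< = begin
    c * e ^ p + c        ≤⟨ power-bound c p 2 L e (below-double-succ (m^n>0 2 L) e<) ⟩
    2 ^ (L * p) * a      ≤⟨ *-monoʳ-≤ (2 ^ (L * p)) (<⇒≤ (n<2^n a)) ⟩
    2 ^ (L * p) * 2 ^ a  ≡⟨ sym (^-distribˡ-+-* 2 (L * p) a) ⟩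
    2 ^ (L * p + a)      ≡⟨ cong (2 ^_) (sym (exponent-horner a p n)) ⟩
    hi                   ∎
    where open ≤-Reasoning

-- Lemma 2.5.  The bound holds from N = 0 on, and the argument does not
-- need the hypothesis p ≥ 1.
lemma2p5 : ExcludedMiddle 0ℓ →
    (φ : Numbering) (p : ℕ) → 1 ≤ p → PolyBounded φ p →
    Σ ℕ λ a → 1 ≤ a × Σ ℕ λ N → ∀ n → N ≤ n →
    ScaledMoreThan (a * p ^ n) (M φ) (2 ^ (a * d p n)) (2 ^ (a * d p (n + 1)))
lemma2p5 lem φ p _ bounded =
  let (c , 1≤c , m , m-injective , m-good) = χ-indices lem φ p bounded
  in scale c p , scale-positive p 1≤c ,
     0 , λ n _ → dense-intervals c p m m-injective m-good n
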